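{- Let $f:\{0,1\}^n\to\{0,1\}$ and let $\mu$ be a probability distribution on $\{0,1\}^n$ with $\mu(f^{ -1}(0)) = 1/2$. Let $\epsilon \le 1/8$. If there is an $\epsilon$-error randomized parity decision tree of cost $c$ computing $f$, then there exists an affine subspace $W\subseteq \mathbb{F}_2^n$ such that $\mu(W\cap f^{ -1}(1)) \le 4\epsilon\,\mu(W)$ and $\mathrm{codim}(W)\le c$.
   Context: A parity decision tree is a rooted binary tree in which each internal node is labelled by a set $S\subseteq[n]$ and queries $\bigoplus_{i\in S}x_i$, proceeding to the child along the edge labelled by the answer; leaves are labelled by an output bit. Its cost is its height. A randomized parity decision tree of cost $c$ is a probability distribution over deterministic parity decision trees of cost $c$; it is $\epsilon$-error for $f$ if $\Pr[T(x)=f(x)]\ge 1-\epsilon$ for every $x$. The codimension of an affine subspace $W=a+S$ is $n-\dim(S)$.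
   Formalization: The distribution μ and the probabilities of the randomized parity decision tree take rational values, and the error ε is rational. -}

module Defs where

open import Data.Bool using (Bool; true; false; _xor_; _∧_; if_then_else_; not)
open import Data.Bool.Properties using () renaming (_≟_ to _≟B_)
open import Data.Nat using (ℕ; zero; suc; _∸_)
open import Data.Vec using (Vec; []; _∷_; zipWith; replicate)
open import Data.Vec.Properties using (≡-dec)
open import Data.List using (List; []; _∷_; map; _++_; foldr; length)
open import Data.Bool.ListAction using (any)
open import Data.Product using (_×_; _,_; proj₁; proj₂)
open import Data.Rational using (ℚ; 0ℚ; 1ℚ; _+_; _*_; _-_; _≤_)
open import Relation.Nullary.Decidable using (⌊_⌋)
open import Relation.Binary.PropositionalEquality using (_≡_)
open import Data.List.Relation.Unary.All using (All)

Point : ℕ → Set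
Point n = Vec Bool n

allPoints : (n : ℕ) → List (Point n)
allPoints zero = [] ∷ []
allPoints (suc n) = map (false ∷_) (allPoints n) ++ map (true ∷_) (allPoints n)

_⊕_ : ∀ {n} → Point n → Point n → Point n
_⊕_ = zipWith _xor_

zeroV : ∀ {n} → Point n
zeroV = replicate _ false

-- parity ⊕_{i ∈ S} x_i, with S ⊆ [n] given as its indicator vector
parity : ∀ {n} → Vec Bool n → Point n → Bool
parity [] [] = false
parity (s ∷ S) (x ∷ xs) = (s ∧ x) xor parity S xs

-- Parity decision trees of height at most c
data PDT (n : ℕ) : ℕ → Set where
  leaf : ∀ {c} → Bool → PDT n c
  node : ∀ {c} → (S : Vec Bool n) → (ifFalse ifTrue : PDT n c) → PDT n (suc c)

run : ∀ {n c} → PDT n c → Point n → Bool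
run (leaf b) x = b
run (node S t₀ t₁) x = if parity S x then run t₁ x else run t₀ x

sumℚ : List ℚ → ℚ
sumℚ = foldr _+_ 0ℚ

-- A (finitely supported) randomized PDT of cost c: weighted list of PDTs
RPDT : ℕ → ℕ → Set
RPDT n c = List (ℚ × PDT n c)

IsDistributionR : ∀ {n c} → RPDT n c → Set
IsDistributionR R = All (λ p → 0ℚ ≤ proj₁ p) R × sumℚ (map proj₁ R) ≡ 1ℚ

probOut : ∀ {n c} → RPDT n c → Point n → Bool → ℚ
probOut R x b = sumℚ (map (λ p → if ⌊ run (proj₂ p) x ≟B b ⌋ then proj₁ p else 0ℚ) R)

EpsErr : ∀ {n c} → (f : Point n → Bool) → ℚ → RPDT n c → Set
EpsErr {n} f ε R = IsDistributionR R × (∀ (x : Point n) → 1ℚ - ε ≤ probOut R x (f x))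

IsDistribution : ∀ {n} → (Point n → ℚ) → Set
IsDistribution {n} μ = (∀ x → 0ℚ ≤ μ x) × sumℚ (map μ (allPoints n)) ≡ 1ℚ

measure : ∀ {n} → (Point n → ℚ) → (Point n → Bool) → ℚ
measure {n} μ A = sumℚ (map (λ x → if A x then μ x else 0ℚ) (allPoints n))

combo : ∀ {n} → (B : List (Point n)) → Vec Bool (length B) → Point n
combo [] [] = zeroV
combo (b ∷ B) (true ∷ cs) = b ⊕ combo B cs
combo (b ∷ B) (false ∷ cs) = combo B cs

LinIndep : ∀ {n} → List (Point n) → Set
LinIndep B = ∀ cs → combo B cs ≡ zeroV → cs ≡ replicate _ false

record Affine (n : ℕ) : Set where
  field
    shift : Point n
    basis : List (Point n)
    indep : LinIndep basis

  dim : ℕ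
  dim = length basis

  codim : ℕ
  codim = n ∸ dim

  member : Point n → Bool
  member x = any (λ cs → ⌊ ≡-dec _≟B_ (shift ⊕ combo basis cs) x ⌋) (allPoints (length basis))

open Affine public

_∩_ : ∀ {n} → (Point n → Bool) → (Point n → Bool) → (Point n → Bool)
(A ∩ B) x = A x ∧ B x

preimage : ∀ {n} → (Point n → Bool) → Bool → (Point n → Bool)
preimage f b x = ⌊ f x ≟B b ⌋

module Submission where

-- Averaging the error over the random choices yields one tree t in the support whose μ-error is
-- at most ε. Then μ(t⁻¹(0) ∩ f⁻¹(1)) ≤ ε while μ(t⁻¹(0)) ≥ μ(f⁻¹(0)) − ε ≥ 3/8. The inputs
-- reaching a fixed 0-leaf of t form an affine subspace of codimension at most the depth, since
-- each query cuts by a parity hyperplane, and these subspaces partition t⁻¹(0). Averaging once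
-- more, one of them satisfies μ(W ∩ f⁻¹(1)) ≤ (8/3) ε μ(W) ≤ 4ε μ(W).

open import Algebra.Bundles using (CommutativeMonoid; CommutativeRing)
import Algebra.Properties.CommutativeSemigroup as CommutativeSemigroupProperties
open import Data.Bool using (Bool; true; false; T; not; _xor_; _∧_; if_then_else_)
open import Data.Bool.Properties
  using (xor-∧-commutativeRing; xor-comm; xor-assoc; xor-identityˡ; xor-identityʳ; xor-same;
         ∧-distribˡ-xor; ∧-zeroʳ; ∧-identityʳ; T-∧)
  renaming (_≟_ to _≟B_)
open import Data.Empty using (⊥-elim)
open import Data.Integer using (+_)
open import Data.List using (List; []; _∷_; map; length; _++_)
open import Data.List.Membership.Propositional using (_∈_; lose)
open import Data.List.Membership.Propositional.Properties using (∈-map⁺; ∈-++⁺ˡ; ∈-++⁺ʳ)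
open import Data.List.Properties using (length-map)
open import Data.List.Relation.Unary.All using (All; []; _∷_)
import Data.List.Relation.Unary.All as All
open import Data.List.Relation.Unary.All.Properties using (++⁺)
open import Data.List.Relation.Unary.Any using (Any; here; there; satisfied)
import Data.List.Relation.Unary.Any as Any
open import Data.List.Relation.Unary.Any.Properties using (any⁺; any⁻; lookup-result)
open import Data.Nat as ℕ using (ℕ; zero; suc; _∸_) renaming (_≤_ to _ℕ≤_)
import Data.Nat.Properties as ℕₚ
open import Data.Product using (Σ; _×_; _,_; proj₁; proj₂)
open import Data.Rational using (ℚ; 0ℚ; 1ℚ; _+_; _-_; -_; _*_; _/_; _≤_; _<_; ½; nonNegative; positive)
open import Data.Rational.Properties
  using (+-assoc; +-comm; +-identityˡ; +-identityʳ; +-inverseˡ; +-0-commutativeMonoid;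
         *-assoc; *-comm; *-identityʳ; *-zeroʳ; *-distribˡ-+;
         ≤-refl; ≤-trans; ≤-reflexive; ≤-antisym; <-irrefl; <-≤-trans; <⇒≤; ≮⇒≥; ≰⇒>; _≤?_; _<?_;
         +-mono-≤; +-monoˡ-≤; +-monoʳ-≤; +-mono-≤-<; +-mono-<-≤;
         *-monoˡ-≤-nonNeg; *-cancelˡ-≤-pos; positive⁻¹; nonNegative⁻¹; module ≤-Reasoning)
open import Data.Sum using (_⊎_; inj₁; inj₂; [_,_]′)
open import Data.Vec using (Vec; _∷_; []; replicate; cast)
open import Data.Vec.Properties
  using (zipWith-comm; zipWith-assoc; zipWith-identityˡ; zipWith-identityʳ; ∷-injective; cast-sym)
open import Function.Bundles using (_⇔_; mk⇔; Equivalence)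
open import Relation.Binary.PropositionalEquality
open import Relation.Nullary using (yes; no)
open import Relation.Nullary.Decidable using (⌊_⌋; toWitness; fromWitness)

open import Defs

private variable k m n : ℕ

xor-interchange : ∀ a b c d → (a xor b) xor (c xor d) ≡ (a xor c) xor (b xor d)
xor-interchange = interchange
  where open CommutativeSemigroupProperties (CommutativeRing.+-commutativeSemigroup xor-∧-commutativeRing)

xor-cancelˡ : ∀ a b → a xor (a xor b) ≡ b
xor-cancelˡ a b = trans (sym (xor-assoc a a b)) (cong (_xor b) (xor-same a))

xor-cancelʳ : ∀ a b → (a xor b) xor b ≡ a
xor-cancelʳ a b = trans (xor-assoc a b b) (trans (cong (a xor_) (xor-same b)) (xor-identityʳ a))

T-ext : {a b : Bool} → (T a → T b) → (T b → T a) → a ≡ b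
T-ext {false} {false} _ _ = refl
T-ext {false} {true}  _ g = ⊥-elim (g _)
T-ext {true}  {false} f _ = ⊥-elim (f _)
T-ext {true}  {true}  _ _ = refl

⊕-comm : (x y : Point n) → x ⊕ y ≡ y ⊕ x
⊕-comm = zipWith-comm xor-comm

⊕-assoc : (x y z : Point n) → (x ⊕ y) ⊕ z ≡ x ⊕ (y ⊕ z)
⊕-assoc = zipWith-assoc xor-assoc

⊕-identityˡ : (x : Point n) → zeroV ⊕ x ≡ x
⊕-identityˡ = zipWith-identityˡ xor-identityˡ

⊕-identityʳ : (x : Point n) → x ⊕ zeroV ≡ x
⊕-identityʳ = zipWith-identityʳ xor-identityʳ

⊕-self : (x : Point n) → x ⊕ x ≡ zeroV
⊕-self [] = refl
⊕-self (a ∷ x) = cong₂ _∷_ (xor-same a) (⊕-self x)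

⊕-interchange : (w x y z : Point n) → (w ⊕ x) ⊕ (y ⊕ z) ≡ (w ⊕ y) ⊕ (x ⊕ z)
⊕-interchange [] [] [] [] = refl
⊕-interchange (a ∷ w) (b ∷ x) (c ∷ y) (d ∷ z) =
  cong₂ _∷_ (xor-interchange a b c d) (⊕-interchange w x y z)

scale : Bool → Point n → Point n
scale u x = if u then x else zeroV

scale-xor : ∀ u v (x : Point n) → scale (u xor v) x ≡ scale u x ⊕ scale v x
scale-xor false v     x = sym (⊕-identityˡ _)
scale-xor true  false x = sym (⊕-identityʳ x)
scale-xor true  true  x = sym (⊕-self x)

parity-⊕ : (S x y : Point n) → parity S (x ⊕ y) ≡ parity S x xor parity S y
parity-⊕ [] [] [] = refl
parity-⊕ (s ∷ S) (a ∷ x) (b ∷ y) = begin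
    (s ∧ (a xor b)) xor parity S (x ⊕ y)
  ≡⟨ cong₂ _xor_ (∧-distribˡ-xor s a b) (parity-⊕ S x y) ⟩
    ((s ∧ a) xor (s ∧ b)) xor (parity S x xor parity S y)
  ≡⟨ xor-interchange (s ∧ a) (s ∧ b) (parity S x) (parity S y) ⟩
    ((s ∧ a) xor parity S x) xor ((s ∧ b) xor parity S y)
  ∎
  where open ≡-Reasoning

parity-zeroV : (S : Point n) → parity S zeroV ≡ false
parity-zeroV [] = refl
parity-zeroV (s ∷ S) = cong₂ _xor_ (∧-zeroʳ s) (parity-zeroV S)

parity-scale : (S : Point n) (u : Bool) (x : Point n) → parity S (scale u x) ≡ u ∧ parity S x
parity-scale S true  x = refl
parity-scale S false x = parity-zeroV S

combo-∷ : (b : Point n) (B : List (Point n)) (u : Bool) (cs : Vec Bool (length B)) →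
  combo (b ∷ B) (u ∷ cs) ≡ scale u b ⊕ combo B cs
combo-∷ b B true  cs = refl
combo-∷ b B false cs = sym (⊕-identityˡ _)

combo-replicate : (B : List (Point n)) → combo B (replicate _ false) ≡ zeroV
combo-replicate []      = refl
combo-replicate (b ∷ B) = combo-replicate B

combo-swap : (p b : Point n) (B : List (Point n)) (u v : Bool) (cs : Vec Bool (length B)) →
  combo (p ∷ b ∷ B) (u ∷ v ∷ cs) ≡ scale v b ⊕ combo (p ∷ B) (u ∷ cs)
combo-swap p b B u v cs = begin
    combo (p ∷ b ∷ B) (u ∷ v ∷ cs)       ≡⟨ combo-∷ p (b ∷ B) u (v ∷ cs) ⟩
    scale u p ⊕ combo (b ∷ B) (v ∷ cs)   ≡⟨ cong (scale u p ⊕_) (combo-∷ b B v cs) ⟩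
    scale u p ⊕ (scale v b ⊕ combo B cs) ≡⟨ sym (⊕-assoc _ _ _) ⟩
    (scale u p ⊕ scale v b) ⊕ combo B cs ≡⟨ cong (_⊕ combo B cs) (⊕-comm _ _) ⟩
    (scale v b ⊕ scale u p) ⊕ combo B cs ≡⟨ ⊕-assoc _ _ _ ⟩
    scale v b ⊕ (scale u p ⊕ combo B cs) ≡⟨ cong (scale v b ⊕_) (sym (combo-∷ p B u cs)) ⟩
    scale v b ⊕ combo (p ∷ B) (u ∷ cs)   ∎
  where open ≡-Reasoning

cast-replicate : ∀ {A : Set} .(eq : m ≡ n) (a : A) → cast eq (replicate m a) ≡ replicate n a
cast-replicate {zero}  {zero}  eq a = refl
cast-replicate {suc m} {suc n} eq a = cong (a ∷_) (cast-replicate {m} {n} (cong ℕ.pred eq) a)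

replicate-cast : ∀ {A : Set} {a : A} .(eq : m ≡ n) (cs : Vec A m) → cast eq cs ≡ replicate n a → cs ≡ replicate m a
replicate-cast eq cs h = trans (sym (cast-sym eq h)) (cast-replicate (sym eq) _)

record IsLinear (g : Point n → Point m) : Set where
  field
    map-zeroV : g zeroV ≡ zeroV
    map-⊕     : ∀ x y → g (x ⊕ y) ≡ g x ⊕ g y

combo-map : {g : Point n → Point m} → IsLinear g →
  (B : List (Point n)) (cs : Vec Bool (length (map g B))) →
  combo (map g B) cs ≡ g (combo B (cast (length-map g B) cs))
combo-map lin []      []           = sym (IsLinear.map-zeroV lin)
combo-map lin (b ∷ B) (true  ∷ cs) =
  trans (cong (_ ⊕_) (combo-map lin B cs)) (sym (IsLinear.map-⊕ lin _ _))
combo-map lin (b ∷ B) (false ∷ cs) = combo-map lin B cs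

-- Linear independence and pivots

_∈Span_ : Point n → List (Point n) → Set
v ∈Span B = Σ (Vec Bool (length B)) λ cs → combo B cs ≡ v

LinIndep-tail : (b : Point n) (B : List (Point n)) → LinIndep (b ∷ B) → LinIndep B
LinIndep-tail b B ind cs eq = proj₂ (∷-injective (ind (false ∷ cs) eq))

Annihilates : Point n → List (Point n) → Set
Annihilates S B = ∀ cs → parity S (combo B cs) ≡ false

annihilates-∷ : (S b : Point n) (B : List (Point n)) →
  parity S b ≡ false → Annihilates S B → Annihilates S (b ∷ B)
annihilates-∷ S b B even ann (u ∷ cs) = begin
    parity S (combo (b ∷ B) (u ∷ cs))                ≡⟨ cong (parity S) (combo-∷ b B u cs) ⟩
    parity S (scale u b ⊕ combo B cs)                ≡⟨ parity-⊕ S _ _ ⟩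
    parity S (scale u b) xor parity S (combo B cs)   ≡⟨ cong₂ _xor_ (parity-scale S u b) (ann cs) ⟩
    (u ∧ parity S b) xor false                       ≡⟨ cong (λ t → (u ∧ t) xor false) even ⟩
    (u ∧ false) xor false                            ≡⟨ cong (_xor false) (∧-zeroʳ u) ⟩
    false                                            ∎
  where open ≡-Reasoning

record Pivot (S : Point n) (B : List (Point n)) : Set where
  field
    pivot        : Point n
    rest         : List (Point n)
    length-rest  : suc (length rest) ≡ length B
    pivot-odd    : parity S pivot ≡ true
    rest-even    : Annihilates S rest
    independent  : LinIndep (pivot ∷ rest)
    span-⊆       : ∀ cs → combo B cs ∈Span (pivot ∷ rest)
    span-⊇       : ∀ cs → combo (pivot ∷ rest) cs ∈Span B

-- Gaussian elimination with the S-odd pivot b: r ↦ r + (S·r) b sends the other basis vectors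
-- into ker S without changing the span.
module PivotAtHead (S b : Point n) (B : List (Point n))
                   (odd : parity S b ≡ true) (ind : LinIndep (b ∷ B)) where

  clear : Point n → Point n
  clear r = scale (parity S r) b ⊕ r

  clear-linear : IsLinear clear
  clear-linear = record
    { map-zeroV = trans (cong (λ t → scale t b ⊕ zeroV) (parity-zeroV S)) (⊕-identityˡ zeroV)
    ; map-⊕     = λ x y → trans (cong (λ t → scale t b ⊕ (x ⊕ y)) (parity-⊕ S x y))
                             (trans (cong (_⊕ (x ⊕ y)) (scale-xor _ _ b)) (⊕-interchange _ _ x y))
    }

  parity-clear : ∀ r → parity S (clear r) ≡ false
  parity-clear r = begin
    parity S (scale (parity S r) b ⊕ r)          ≡⟨ parity-⊕ S _ r ⟩
    parity S (scale (parity S r) b) xor parity S r ≡⟨ cong (_xor parity S r) (parity-scale S _ b) ⟩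
    (parity S r ∧ parity S b) xor parity S r     ≡⟨ cong (λ t → (parity S r ∧ t) xor parity S r) odd ⟩
    (parity S r ∧ true) xor parity S r           ≡⟨ cong (_xor parity S r) (∧-identityʳ (parity S r)) ⟩
    parity S r xor parity S r                    ≡⟨ xor-same (parity S r) ⟩
    false                                        ∎
    where open ≡-Reasoning

  rest : List (Point n)
  rest = map clear B

  toB : Vec Bool (length rest) → Vec Bool (length B)
  toB = cast (length-map clear B)

  fromB : Vec Bool (length B) → Vec Bool (length rest)
  fromB = cast (sym (length-map clear B))

  correction : Vec Bool (length rest) → Bool
  correction cs = parity S (combo B (toB cs))

  combo-rest : ∀ u cs → combo (b ∷ rest) (u ∷ cs) ≡ combo (b ∷ B) ((u xor correction cs) ∷ toB cs)
  combo-rest u cs = begin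
      combo (b ∷ rest) (u ∷ cs)                  ≡⟨ combo-∷ b rest u cs ⟩
      scale u b ⊕ combo rest cs                  ≡⟨ cong (scale u b ⊕_) (combo-map clear-linear B cs) ⟩
      scale u b ⊕ (scale t b ⊕ X)                ≡⟨ sym (⊕-assoc _ _ X) ⟩
      (scale u b ⊕ scale t b) ⊕ X                ≡⟨ cong (_⊕ X) (sym (scale-xor u t b)) ⟩
      scale (u xor t) b ⊕ X                      ≡⟨ sym (combo-∷ b B (u xor t) (toB cs)) ⟩
      combo (b ∷ B) ((u xor t) ∷ toB cs)         ∎
    where
    open ≡-Reasoning
    X = combo B (toB cs)
    t = correction cs

  pivot-head : Pivot S (b ∷ B)
  pivot-head = record
    { pivot       = b
    ; rest        = rest
    ; length-rest = cong suc (length-map clear B)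
    ; pivot-odd   = odd
    ; rest-even   = λ cs → trans (cong (parity S) (combo-map clear-linear B cs)) (parity-clear _)
    ; independent = independent
    ; span-⊆      = span-⊆
    ; span-⊇      = λ { (u ∷ cs) → ((u xor correction cs) ∷ toB cs) , sym (combo-rest u cs) }
    }
    where
    independent : LinIndep (b ∷ rest)
    independent (u ∷ cs) eq with ∷-injective (ind _ (trans (sym (combo-rest u cs)) eq))
    ... | u+t≡0 , toB≡0 = cong₂ _∷_ u≡0 cs≡0
      where
      t≡0 : correction cs ≡ false
      t≡0 = trans (cong (λ ds → parity S (combo B ds)) toB≡0)
                  (trans (cong (parity S) (combo-replicate B)) (parity-zeroV S))
      u≡0 : u ≡ false
      u≡0 = trans (sym (xor-identityʳ u)) (trans (cong (u xor_) (sym t≡0)) u+t≡0)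
      cs≡0 : cs ≡ replicate _ false
      cs≡0 = replicate-cast (length-map clear B) cs toB≡0
    span-⊆ : ∀ cs → combo (b ∷ B) cs ∈Span (b ∷ rest)
    span-⊆ (v ∷ cs) = ((v xor correction (fromB cs)) ∷ fromB cs) , (begin
        combo (b ∷ rest) ((v xor t) ∷ fromB cs)          ≡⟨ combo-rest (v xor t) (fromB cs) ⟩
        combo (b ∷ B) (((v xor t) xor t) ∷ toB (fromB cs))
          ≡⟨ cong₂ (λ w ds → combo (b ∷ B) (w ∷ ds)) (xor-cancelʳ v t) (cast-sym (sym (length-map clear B)) refl) ⟩
        combo (b ∷ B) (v ∷ cs)                           ∎)
      where
      open ≡-Reasoning
      t = correction (fromB cs)

open PivotAtHead using (pivot-head)

pivot-∷ : (S b : Point n) (B : List (Point n)) → parity S b ≡ false → LinIndep (b ∷ B) →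
  Pivot S B → Pivot S (b ∷ B)
pivot-∷ S b B even ind piv = record
  { pivot       = pivot
  ; rest        = b ∷ rest
  ; length-rest = cong suc length-rest
  ; pivot-odd   = pivot-odd
  ; rest-even   = annihilates-∷ S b rest even rest-even
  ; independent = independent′
  ; span-⊆      = span-⊆′
  ; span-⊇      = span-⊇′
  }
  where
  open Pivot piv
  independent′ : LinIndep (pivot ∷ b ∷ rest)
  independent′ (u ∷ v ∷ cs) eq with span-⊇ (u ∷ cs)
  ... | ds , ds≡ with ∷-injective (ind (v ∷ ds) (begin
        combo (b ∷ B) (v ∷ ds)                    ≡⟨ combo-∷ b B v ds ⟩
        scale v b ⊕ combo B ds                    ≡⟨ cong (scale v b ⊕_) ds≡ ⟩
        scale v b ⊕ combo (pivot ∷ rest) (u ∷ cs) ≡⟨ sym (combo-swap pivot b rest u v cs) ⟩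
        combo (pivot ∷ b ∷ rest) (u ∷ v ∷ cs)     ≡⟨ eq ⟩
        zeroV                                     ∎))
    where open ≡-Reasoning
  ... | v≡0 , ds≡0
    with ∷-injective (independent (u ∷ cs) (trans (sym ds≡) (trans (cong (combo B) ds≡0) (combo-replicate B))))
  ...   | u≡0 , cs≡0 = cong₂ _∷_ u≡0 (cong₂ _∷_ v≡0 cs≡0)
  span-⊆′ : ∀ cs → combo (b ∷ B) cs ∈Span (pivot ∷ b ∷ rest)
  span-⊆′ (v ∷ cs) with span-⊆ cs
  ... | (u ∷ ds) , ds≡ = (u ∷ v ∷ ds) ,
        trans (combo-swap pivot b rest u v ds) (trans (cong (scale v b ⊕_) ds≡) (sym (combo-∷ b B v cs)))
  span-⊇′ : ∀ cs → combo (pivot ∷ b ∷ rest) cs ∈Span (b ∷ B)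
  span-⊇′ (u ∷ v ∷ ds) with span-⊇ (u ∷ ds)
  ... | cs , cs≡ = (v ∷ cs) ,
        trans (combo-∷ b B v cs) (trans (cong (scale v b ⊕_) cs≡) (sym (combo-swap pivot b rest u v ds)))

annihilates-or-pivot : (S : Point n) (B : List (Point n)) → LinIndep B → Annihilates S B ⊎ Pivot S B
annihilates-or-pivot S []      ind = inj₁ λ { [] → parity-zeroV S }
annihilates-or-pivot S (b ∷ B) ind with parity S b in eq
... | true  = inj₂ (pivot-head S b B eq ind)
... | false with annihilates-or-pivot S B (LinIndep-tail b B ind)
...   | inj₁ ann = inj₁ (annihilates-∷ S b B eq ann)
...   | inj₂ piv = inj₂ (pivot-∷ S b B eq ind piv)

-- Affine subspaces cut by a parity hyperplane

∈-allPoints : (cs : Vec Bool m) → cs ∈ allPoints m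
∈-allPoints []           = here refl
∈-allPoints (false ∷ cs) = ∈-++⁺ˡ (∈-map⁺ (false ∷_) (∈-allPoints cs))
∈-allPoints (true  ∷ cs) = ∈-++⁺ʳ _ (∈-map⁺ (true ∷_) (∈-allPoints cs))

_∈Affine_ : Point n → Affine n → Set
x ∈Affine W = Σ (Vec Bool (dim W)) λ cs → shift W ⊕ combo (basis W) cs ≡ x

member-sound : (W : Affine n) (x : Point n) → T (member W x) → x ∈Affine W
member-sound W x mx with satisfied (any⁻ _ (allPoints (dim W)) mx)
... | cs , hit = cs , toWitness hit

member-complete : (W : Affine n) (x : Point n) → x ∈Affine W → T (member W x)
member-complete W x (cs , eq) = any⁺ _ (lose (∈-allPoints cs) (fromWitness eq))

hyperplane : Point n → Bool → Point n → Bool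
hyperplane S = preimage (parity S)

∈-∩-hyperplane : (W : Affine n) (S : Point n) (β : Bool) (x : Point n) →
  T ((member W ∩ hyperplane S β) x) ⇔ (T (member W x) × parity S x ≡ β)
∈-∩-hyperplane W S β x = mk⇔
  (λ h → let mx , px = Equivalence.to T-∧ h in mx , toWitness px)
  (λ { (mx , px) → Equivalence.from T-∧ (mx , fromWitness px) })

record Restriction (W : Affine n) (S : Point n) (β : Bool) : Set where
  field
    subspace : Affine n
    codim-≤  : codim subspace ℕ≤ suc (codim W)
    member-≡ : ∀ x → member subspace x ≡ (member W ∩ hyperplane S β) x

RestrictionOrEmpty : Affine n → Point n → Bool → Set
RestrictionOrEmpty W S β = (∀ x → (member W ∩ hyperplane S β) x ≡ false) ⊎ Restriction W S β

m∸n≤1+[m∸1+n] : ∀ m n → m ∸ n ℕ≤ suc (m ∸ suc n)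
m∸n≤1+[m∸1+n] m n =
  ℕₚ.m≤n+o⇒m∸n≤o m n (ℕₚ.≤-trans (ℕₚ.m≤n+m∸n m (suc n)) (ℕₚ.≤-reflexive (sym (ℕₚ.+-suc n _))))

parity-constant : (W : Affine n) (S : Point n) → Annihilates S (basis W) →
  ∀ x → T (member W x) → parity S x ≡ parity S (shift W)
parity-constant W S ann x mx with member-sound W x mx
... | cs , refl = trans (parity-⊕ S _ _) (trans (cong (parity S (shift W) xor_) (ann cs)) (xor-identityʳ _))

-- If S vanishes on the direction space, W lies in one of the hyperplanes S·x = 0, 1. Otherwise a
-- pivot leaves the basis, and moving the shift by the pivot lands it in S·x = β.
module _ (W : Affine n) (S : Point n) (β : Bool) where

  restrict-annihilated : Annihilates S (basis W) → RestrictionOrEmpty W S β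
  restrict-annihilated ann with parity S (shift W) ≟B β
  ... | yes s≡β = inj₂ record
    { subspace = W
    ; codim-≤  = ℕₚ.n≤1+n _
    ; member-≡ = λ x → T-ext
        (λ mx → Equivalence.from (∈-∩-hyperplane W S β x) (mx , trans (parity-constant W S ann x mx) s≡β))
        (λ h → proj₁ (Equivalence.to (∈-∩-hyperplane W S β x) h))
    }
  ... | no s≢β = inj₁ λ x → T-ext (λ h →
    let mx , px = Equivalence.to (∈-∩-hyperplane W S β x) h
    in s≢β (trans (sym (parity-constant W S ann x mx)) px)) λ ()

  restrict-pivot : Pivot S (basis W) → Restriction W S β
  restrict-pivot piv = record
    { subspace = W′
    ; codim-≤  = subst (λ l → n ∸ length rest ℕ≤ suc (n ∸ l)) length-rest (m∸n≤1+[m∸1+n] n (length rest))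
    ; member-≡ = λ x → T-ext (to x) (from x)
    }
    where
    open Pivot piv
    s = shift W
    δ = parity S s xor β

    W′ : Affine n
    W′ = record { shift = s ⊕ scale δ pivot ; basis = rest ; indep = LinIndep-tail pivot rest independent }

    shift-along : ∀ u ds → s ⊕ combo (pivot ∷ rest) (u ∷ ds) ≡ (s ⊕ scale u pivot) ⊕ combo rest ds
    shift-along u ds = trans (cong (s ⊕_) (combo-∷ pivot rest u ds)) (sym (⊕-assoc s _ _))

    parity-along : ∀ u ds → parity S (s ⊕ combo (pivot ∷ rest) (u ∷ ds)) ≡ parity S s xor u
    parity-along u ds = begin
        parity S (s ⊕ combo (pivot ∷ rest) (u ∷ ds))
      ≡⟨ parity-⊕ S s _ ⟩
        parity S s xor parity S (combo (pivot ∷ rest) (u ∷ ds))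
      ≡⟨ cong (λ y → parity S s xor parity S y) (combo-∷ pivot rest u ds) ⟩
        parity S s xor parity S (scale u pivot ⊕ combo rest ds)
      ≡⟨ cong (parity S s xor_) (parity-⊕ S _ _) ⟩
        parity S s xor (parity S (scale u pivot) xor parity S (combo rest ds))
      ≡⟨ cong (λ t → parity S s xor (t xor parity S (combo rest ds))) (parity-scale S u pivot) ⟩
        parity S s xor ((u ∧ parity S pivot) xor parity S (combo rest ds))
      ≡⟨ cong₂ (λ t r → parity S s xor ((u ∧ t) xor r)) pivot-odd (rest-even ds) ⟩
        parity S s xor ((u ∧ true) xor false)
      ≡⟨ cong (parity S s xor_) (trans (xor-identityʳ _) (∧-identityʳ u)) ⟩
        parity S s xor u
      ∎
      where open ≡-Reasoning

    to : ∀ x → T (member W′ x) → T ((member W ∩ hyperplane S β) x)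
    to x mx with member-sound W′ x mx
    ... | cs , refl with span-⊇ (δ ∷ cs)
    ...   | ds , ds≡ = Equivalence.from (∈-∩-hyperplane W S β x) (x∈W , parity≡β)
      where
      x∈W = member-complete W x (ds , trans (cong (s ⊕_) ds≡) (shift-along δ cs))
      parity≡β = begin
        parity S ((s ⊕ scale δ pivot) ⊕ combo rest cs)  ≡⟨ cong (parity S) (sym (shift-along δ cs)) ⟩
        parity S (s ⊕ combo (pivot ∷ rest) (δ ∷ cs))    ≡⟨ parity-along δ cs ⟩
        parity S s xor (parity S s xor β)               ≡⟨ xor-cancelˡ (parity S s) β ⟩
        β                                               ∎
        where open ≡-Reasoning

    from : ∀ x → T ((member W ∩ hyperplane S β) x) → T (member W′ x)
    from x h with Equivalence.to (∈-∩-hyperplane W S β x) h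
    ... | mx , px with member-sound W x mx
    ...   | cs , refl with span-⊆ cs
    ...     | (u ∷ ds) , ds≡ = member-complete W′ _ (ds , (begin
        (s ⊕ scale δ pivot) ⊕ combo rest ds  ≡⟨ cong (λ v → (s ⊕ scale v pivot) ⊕ _) (sym u≡δ) ⟩
        (s ⊕ scale u pivot) ⊕ combo rest ds  ≡⟨ sym (shift-along u ds) ⟩
        s ⊕ combo (pivot ∷ rest) (u ∷ ds)    ≡⟨ cong (s ⊕_) ds≡ ⟩
        s ⊕ combo (basis W) cs               ∎))
      where
      open ≡-Reasoning
      u≡δ : u ≡ δ
      u≡δ = begin
        u                                                  ≡⟨ sym (xor-cancelˡ (parity S s) u) ⟩
        parity S s xor (parity S s xor u)                  ≡⟨ cong (parity S s xor_) (sym (parity-along u ds)) ⟩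
        parity S s xor parity S (s ⊕ combo (pivot ∷ rest) (u ∷ ds))
          ≡⟨ cong (λ y → parity S s xor parity S (s ⊕ y)) ds≡ ⟩
        parity S s xor parity S (s ⊕ combo (basis W) cs)   ≡⟨ cong (parity S s xor_) px ⟩
        δ                                                  ∎

  restrict : RestrictionOrEmpty W S β
  restrict with annihilates-or-pivot S (basis W) (indep W)
  ... | inj₁ ann = restrict-annihilated ann
  ... | inj₂ piv = inj₂ (restrict-pivot piv)

standardBasis : (n : ℕ) → List (Point n)
standardBasis zero    = []
standardBasis (suc n) = (true ∷ zeroV) ∷ map (false ∷_) (standardBasis n)

∷-linear : IsLinear {n} (false ∷_)
∷-linear = record { map-zeroV = refl ; map-⊕ = λ _ _ → refl }

module _ {n : ℕ} where
  private
    E  = standardBasis n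
    eq = length-map (false ∷_) E

  combo-standardBasis : ∀ a cs →
    combo (standardBasis (suc n)) (a ∷ cs) ≡ a ∷ combo E (cast eq cs)
  combo-standardBasis a cs = begin
      combo (standardBasis (suc n)) (a ∷ cs)                ≡⟨ combo-∷ _ _ a cs ⟩
      scale a (true ∷ zeroV) ⊕ combo (map (false ∷_) E) cs
        ≡⟨ cong (scale a (true ∷ zeroV) ⊕_) (combo-map ∷-linear E cs) ⟩
      scale a (true ∷ zeroV) ⊕ (false ∷ combo E (cast eq cs)) ≡⟨ unit a ⟩
      a ∷ combo E (cast eq cs)                              ∎
    where
    open ≡-Reasoning
    unit : ∀ a → scale a (true ∷ zeroV) ⊕ (false ∷ combo E (cast eq cs)) ≡ a ∷ combo E (cast eq cs)
    unit true  = cong (true ∷_) (⊕-identityˡ _)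
    unit false = cong (false ∷_) (⊕-identityˡ _)

standardBasis-spans : (x : Point n) → x ∈Span standardBasis n
standardBasis-spans []      = [] , refl
standardBasis-spans {suc n} (a ∷ x) with standardBasis-spans x
... | cs , cs≡ = (a ∷ cast (sym eq) cs) ,
      trans (combo-standardBasis a _) (cong (a ∷_) (trans (cong (combo (standardBasis n)) (cast-sym (sym eq) refl)) cs≡))
  where eq = length-map (false ∷_) (standardBasis n)

standardBasis-independent : LinIndep (standardBasis n)
standardBasis-independent {zero}  []       _  = refl
standardBasis-independent {suc n} (a ∷ cs) eq with ∷-injective (trans (sym (combo-standardBasis a cs)) eq)
... | a≡0 , combo≡0 = cong₂ _∷_ a≡0 (replicate-cast _ cs (standardBasis-independent _ combo≡0))

length-standardBasis : (n : ℕ) → length (standardBasis n) ≡ n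
length-standardBasis zero    = refl
length-standardBasis (suc n) = cong suc (trans (length-map (false ∷_) (standardBasis n)) (length-standardBasis n))

fullSpace : (n : ℕ) → Affine n
fullSpace n = record { shift = zeroV ; basis = standardBasis n ; indep = standardBasis-independent }

member-fullSpace : (x : Point n) → T (member (fullSpace n) x)
member-fullSpace {n} x with standardBasis-spans x
... | cs , cs≡ = member-complete (fullSpace n) x (cs , trans (⊕-identityˡ _) cs≡)

codim-fullSpace : (n : ℕ) → codim (fullSpace n) ≡ 0
codim-fullSpace n = trans (cong (n ∸_) (length-standardBasis n)) (ℕₚ.n∸n≡0 n)

∑ : {A : Set} → List A → (A → ℚ) → ℚ
∑ xs g = sumℚ (map g xs)

syntax ∑ xs (λ x → e) = ∑[ x ∈ xs ] e

module _ {A : Set} where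

  ∑-cong : (xs : List A) {g h : A → ℚ} → (∀ x → g x ≡ h x) → ∑ xs g ≡ ∑ xs h
  ∑-cong []       eq = refl
  ∑-cong (x ∷ xs) eq = cong₂ _+_ (eq x) (∑-cong xs eq)

  ∑-zero : (xs : List A) {g : A → ℚ} → (∀ x → g x ≡ 0ℚ) → ∑ xs g ≡ 0ℚ
  ∑-zero []       eq = refl
  ∑-zero (x ∷ xs) eq = trans (cong₂ _+_ (eq x) (∑-zero xs eq)) (+-identityˡ 0ℚ)

  ∑-+ : (xs : List A) (g h : A → ℚ) → ∑[ x ∈ xs ] (g x + h x) ≡ ∑ xs g + ∑ xs h
  ∑-+ []       g h = refl
  ∑-+ (x ∷ xs) g h = trans (cong (_+_ (g x + h x)) (∑-+ xs g h)) (interchange (g x) (h x) _ _)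
    where open CommutativeSemigroupProperties (CommutativeMonoid.commutativeSemigroup +-0-commutativeMonoid)

  ∑-*ˡ : (xs : List A) (c : ℚ) (g : A → ℚ) → ∑[ x ∈ xs ] (c * g x) ≡ c * ∑ xs g
  ∑-*ˡ []       c g = sym (*-zeroʳ c)
  ∑-*ˡ (x ∷ xs) c g = trans (cong (_+_ (c * g x)) (∑-*ˡ xs c g)) (sym (*-distribˡ-+ c (g x) _))

  ∑-++ : (xs ys : List A) (g : A → ℚ) → ∑ (xs ++ ys) g ≡ ∑ xs g + ∑ ys g
  ∑-++ []       ys g = sym (+-identityˡ _)
  ∑-++ (x ∷ xs) ys g = trans (cong (_+_ (g x)) (∑-++ xs ys g)) (sym (+-assoc (g x) _ _))

  ∑-mono-≤ : (xs : List A) {g h : A → ℚ} → (∀ x → g x ≤ h x) → ∑ xs g ≤ ∑ xs h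
  ∑-mono-≤ []       le = ≤-refl
  ∑-mono-≤ (x ∷ xs) le = +-mono-≤ (le x) (∑-mono-≤ xs le)

  ∑-nonNeg : (xs : List A) {g : A → ℚ} → (∀ x → 0ℚ ≤ g x) → 0ℚ ≤ ∑ xs g
  ∑-nonNeg []       le = ≤-refl
  ∑-nonNeg (x ∷ xs) le = +-mono-≤ (le x) (∑-nonNeg xs le)

∑-comm : {A B : Set} (xs : List A) (ys : List B) (h : A → B → ℚ) →
  ∑[ x ∈ xs ] ∑[ y ∈ ys ] h x y ≡ ∑[ y ∈ ys ] ∑[ x ∈ xs ] h x y
∑-comm []       ys h = sym (∑-zero ys (λ _ → refl))
∑-comm (x ∷ xs) ys h = trans (cong (_+_ (∑[ y ∈ ys ] h x y)) (∑-comm xs ys h)) (sym (∑-+ ys (h x) _))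

if-nonNeg : ∀ b {m} → 0ℚ ≤ m → 0ℚ ≤ (if b then m else 0ℚ)
if-nonNeg true  m≥0 = m≥0
if-nonNeg false _   = ≤-refl

if-mono : ∀ {a b m} → 0ℚ ≤ m → (T a → T b) → (if a then m else 0ℚ) ≤ (if b then m else 0ℚ)
if-mono {false} {b}     m≥0 _ = if-nonNeg b m≥0
if-mono {true}  {true}  _   _ = ≤-refl
if-mono {true}  {false} _   h = ⊥-elim (h _)

if-subadditive : ∀ {a b c m} → 0ℚ ≤ m → (T a → T b ⊎ T c) →
  (if a then m else 0ℚ) ≤ (if b then m else 0ℚ) + (if c then m else 0ℚ)
if-subadditive {false} {b}     {c}     m≥0 _ = +-mono-≤ (if-nonNeg b m≥0) (if-nonNeg c m≥0)
if-subadditive {true}  {true}  {c} {m} m≥0 _ =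
  ≤-trans (≤-reflexive (sym (+-identityʳ m))) (+-monoʳ-≤ m (if-nonNeg c m≥0))
if-subadditive {true}  {false} {true}  _   _ = ≤-reflexive (sym (+-identityˡ _))
if-subadditive {true}  {false} {false} _   h = [ (λ ()) , (λ ()) ]′ (h _)

indicator : (Point n → ℚ) → (Point n → Bool) → Point n → ℚ
indicator μ A x = if A x then μ x else 0ℚ

module _ (μ : Point n → ℚ) where

  measure-cong : {A B : Point n → Bool} → (∀ x → A x ≡ B x) → measure μ A ≡ measure μ B
  measure-cong eq = ∑-cong (allPoints _) λ x → cong (λ b → if b then μ x else 0ℚ) (eq x)

  measure-empty : {A : Point n → Bool} → (∀ x → A x ≡ false) → measure μ A ≡ 0ℚ
  measure-empty empty = ∑-zero (allPoints _) λ x → cong (λ b → if b then μ x else 0ℚ) (empty x)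

  module _ (μ≥0 : ∀ x → 0ℚ ≤ μ x) where

    measure-nonNeg : (A : Point n → Bool) → 0ℚ ≤ measure μ A
    measure-nonNeg A = ∑-nonNeg (allPoints _) λ x → if-nonNeg (A x) (μ≥0 x)

    measure-mono : {A B : Point n → Bool} → (∀ x → T (A x) → T (B x)) → measure μ A ≤ measure μ B
    measure-mono A⊆B = ∑-mono-≤ (allPoints _) λ x → if-mono (μ≥0 x) (A⊆B x)

    measure-subadditive : {A B C : Point n → Bool} → (∀ x → T (A x) → T (B x) ⊎ T (C x)) →
      measure μ A ≤ measure μ B + measure μ C
    measure-subadditive A⊆B∪C = ≤-trans
      (∑-mono-≤ (allPoints _) λ x → if-subadditive (μ≥0 x) (A⊆B∪C x))
      (≤-reflexive (∑-+ (allPoints n) _ _))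

+-cancel-≤ : ∀ {p q s t} → q ≤ p → p + s ≤ q + t → s ≤ t
+-cancel-≤ q≤p h = ≮⇒≥ λ t<s → <-irrefl refl (<-≤-trans (+-mono-≤-< q≤p t<s) h)

+-cancel-<-≤ : ∀ {p q s t} → q < p → p + s ≤ q + t → s < t
+-cancel-<-≤ q<p h = ≰⇒> λ t≤s → <-irrefl refl (<-≤-trans (+-mono-<-≤ q<p t≤s) h)

+-cancel-≤-< : ∀ {p q s t} → q ≤ p → p + s < q + t → s < t
+-cancel-≤-< q≤p h = ≰⇒> λ t≤s → <-irrefl refl (<-≤-trans h (+-mono-≤ q≤p t≤s))

complement-≤ : ∀ {x y ε} → x + y ≡ 1ℚ → 1ℚ - ε ≤ y → x ≤ ε
complement-≤ {x} {y} {ε} x+y≡1 y≥1-ε = +-cancel-≤ (≤-refl {1ℚ - ε}) (begin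
    (1ℚ - ε) + x   ≤⟨ +-monoˡ-≤ x y≥1-ε ⟩
    y + x          ≡⟨ +-comm y x ⟩
    x + y          ≡⟨ x+y≡1 ⟩
    1ℚ             ≡⟨ sym (+-identityʳ 1ℚ) ⟩
    1ℚ + 0ℚ        ≡⟨ cong (λ z → 1ℚ + z) (sym (+-inverseˡ ε)) ⟩
    1ℚ + (- ε + ε) ≡⟨ sym (+-assoc 1ℚ (- ε) ε) ⟩
    (1ℚ - ε) + ε   ∎)
  where open ≤-Reasoning

*-nonNeg : ∀ {p q} → 0ℚ ≤ p → 0ℚ ≤ q → 0ℚ ≤ p * q
*-nonNeg {p} p≥0 q≥0 = ≤-trans (≤-reflexive (sym (*-zeroʳ p))) (*-monoˡ-≤-nonNeg p {{nonNegative p≥0}} q≥0)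

module _ {A : Set} (r : ℚ) (a b : A → ℚ) where

  RatioAtMost : A → Set
  RatioAtMost x = a x ≤ r * b x × 0ℚ < b x

  private
    classify : ∀ x → 0ℚ ≤ a x → 0ℚ ≤ b x → RatioAtMost x ⊎ (r * b x < a x ⊎ b x ≡ 0ℚ)
    classify x a≥0 b≥0 with a x ≤? r * b x | 0ℚ <? b x
    ... | yes ratio | yes pos = inj₁ (ratio , pos)
    ... | no ¬ratio | _       = inj₂ (inj₁ (≰⇒> ¬ratio))
    ... | yes _     | no ¬pos = inj₂ (inj₂ (≤-antisym (≮⇒≥ ¬pos) b≥0))

    r*0≤a : ∀ x → 0ℚ ≤ a x → b x ≡ 0ℚ → r * b x ≤ a x
    r*0≤a x a≥0 b≡0 = ≤-trans (≤-reflexive (trans (cong (r *_) b≡0) (*-zeroʳ r))) a≥0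

    split-∑ : ∀ x xs → r * ∑ (x ∷ xs) b ≡ r * b x + r * ∑ xs b
    split-∑ x xs = *-distribˡ-+ r (b x) (∑ xs b)

  ratio-witness-< : (xs : List A) → All (λ x → 0ℚ ≤ a x) xs → All (λ x → 0ℚ ≤ b x) xs →
    ∑ xs a < r * ∑ xs b → Any RatioAtMost xs
  ratio-witness-< [] _ _ sum< = ⊥-elim (<-irrefl (sym (*-zeroʳ r)) sum<)
  ratio-witness-< (x ∷ xs) (a≥0 ∷ as≥0) (b≥0 ∷ bs≥0) sum< with classify x a≥0 b≥0
  ... | inj₁ ok = here ok
  ... | inj₂ rest =
    there (ratio-witness-< xs as≥0 bs≥0 (+-cancel-≤-< rb≤a (<-≤-trans sum< (≤-reflexive (split-∑ x xs)))))
    where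
    rb≤a : r * b x ≤ a x
    rb≤a = [ <⇒≤ , r*0≤a x a≥0 ]′ rest

  ratio-witness : (xs : List A) → All (λ x → 0ℚ ≤ a x) xs → All (λ x → 0ℚ ≤ b x) xs →
    ∑ xs a ≤ r * ∑ xs b → 0ℚ < ∑ xs b → Any RatioAtMost xs
  ratio-witness [] _ _ _ pos = ⊥-elim (<-irrefl refl pos)
  ratio-witness (x ∷ xs) (a≥0 ∷ as≥0) (b≥0 ∷ bs≥0) sum≤ pos with classify x a≥0 b≥0
  ... | inj₁ ok = here ok
  ... | inj₂ (inj₁ rb<a) = there (ratio-witness-< xs as≥0 bs≥0 (+-cancel-<-≤ rb<a sum≤′))
    where sum≤′ = ≤-trans sum≤ (≤-reflexive (split-∑ x xs))
  ... | inj₂ (inj₂ b≡0) = there (ratio-witness xs as≥0 bs≥0 (+-cancel-≤ (r*0≤a x a≥0 b≡0) sum≤′) pos′)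
    where
    sum≤′ = ≤-trans sum≤ (≤-reflexive (split-∑ x xs))
    pos′ = <-≤-trans pos (≤-reflexive (trans (cong (_+ ∑ xs b) b≡0) (+-identityˡ _)))

-- The 0-regions of a parity decision tree

zeroSet : PDT n k → Point n → Bool
zeroSet t x = not (run t x)

onRestriction : {W : Affine n} {S : Point n} {β : Bool} →
  (Affine n → List (Affine n)) → RestrictionOrEmpty W S β → List (Affine n)
onRestriction g (inj₁ _) = []
onRestriction g (inj₂ r) = g (Restriction.subspace r)

zeroRegions : PDT n k → Affine n → List (Affine n)
zeroRegions (leaf true)     W = []
zeroRegions (leaf false)    W = W ∷ []
zeroRegions (node S t₀ t₁) W =
  onRestriction (zeroRegions t₀) (restrict W S false) ++ onRestriction (zeroRegions t₁) (restrict W S true)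

zeroRegions-codim : (t : PDT n k) (W : Affine n) → All (λ V → codim V ℕ≤ codim W ℕ.+ k) (zeroRegions t W)
zeroRegions-codim (leaf true)  W = []
zeroRegions-codim (leaf false) W = ℕₚ.m≤m+n _ _ ∷ []
zeroRegions-codim {k = suc k} (node S t₀ t₁) W = ++⁺ (on t₀ (restrict W S false)) (on t₁ (restrict W S true))
  where
  on : ∀ {β} (t : PDT _ k) (r : RestrictionOrEmpty W S β) →
    All (λ V → codim V ℕ≤ codim W ℕ.+ suc k) (onRestriction (zeroRegions t) r)
  on t (inj₁ _) = []
  on t (inj₂ r) = All.map (λ le → ℕₚ.≤-trans le codim′+k≤) (zeroRegions-codim t subspace)
    where
    open Restriction r
    codim′+k≤ : codim subspace ℕ.+ k ℕ≤ codim W ℕ.+ suc k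
    codim′+k≤ = ℕₚ.≤-trans (ℕₚ.+-monoˡ-≤ k codim-≤) (ℕₚ.≤-reflexive (sym (ℕₚ.+-suc _ k)))

module _ (μ : Point n → ℚ) where

  measure-node : (W : Affine n) (S : Point n) (t₀ t₁ : PDT n k) (Q : Point n → Bool) →
    measure μ (member W ∩ (zeroSet (node S t₀ t₁) ∩ Q))
      ≡ measure μ ((member W ∩ hyperplane S false) ∩ (zeroSet t₀ ∩ Q))
      + measure μ ((member W ∩ hyperplane S true) ∩ (zeroSet t₁ ∩ Q))
  measure-node W S t₀ t₁ Q = trans (∑-cong (allPoints n) pointwise) (∑-+ (allPoints n) _ _)
    where
    pointwise : ∀ x → indicator μ (member W ∩ (zeroSet (node S t₀ t₁) ∩ Q)) x
      ≡ indicator μ ((member W ∩ hyperplane S false) ∩ (zeroSet t₀ ∩ Q)) x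
      + indicator μ ((member W ∩ hyperplane S true) ∩ (zeroSet t₁ ∩ Q)) x
    pointwise x with member W x | parity S x
    ... | false | _     = refl
    ... | true  | false = sym (+-identityʳ _)
    ... | true  | true  = sym (+-identityˡ _)

  zeroRegions-measure : (t : PDT n k) (W : Affine n) (Q : Point n → Bool) →
    ∑[ V ∈ zeroRegions t W ] measure μ (member V ∩ Q) ≡ measure μ (member W ∩ (zeroSet t ∩ Q))
  zeroRegions-measure (leaf true)  W Q = sym (measure-empty μ λ x → ∧-zeroʳ (member W x))
  zeroRegions-measure (leaf false) W Q = +-identityʳ _
  zeroRegions-measure (node {k′} S t₀ t₁) W Q = begin
      ∑ (onRestriction (zeroRegions t₀) r₀ ++ onRestriction (zeroRegions t₁) r₁) mass
    ≡⟨ ∑-++ (onRestriction (zeroRegions t₀) r₀) (onRestriction (zeroRegions t₁) r₁) mass ⟩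
      ∑ (onRestriction (zeroRegions t₀) r₀) mass + ∑ (onRestriction (zeroRegions t₁) r₁) mass
    ≡⟨ cong₂ _+_ (on t₀ r₀) (on t₁ r₁) ⟩
      measure μ ((member W ∩ hyperplane S false) ∩ (zeroSet t₀ ∩ Q))
      + measure μ ((member W ∩ hyperplane S true) ∩ (zeroSet t₁ ∩ Q))
    ≡⟨ sym (measure-node W S t₀ t₁ Q) ⟩
      measure μ (member W ∩ (zeroSet (node S t₀ t₁) ∩ Q))
    ∎
    where
    open ≡-Reasoning
    r₀ = restrict W S false
    r₁ = restrict W S true
    mass : Affine n → ℚ
    mass V = measure μ (member V ∩ Q)
    on : ∀ {β} (t : PDT n k′) (r : RestrictionOrEmpty W S β) →
      ∑ (onRestriction (zeroRegions t) r) mass ≡ measure μ ((member W ∩ hyperplane S β) ∩ (zeroSet t ∩ Q))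
    on t (inj₁ empty) = sym (measure-empty μ λ x → cong (_∧ (zeroSet t ∩ Q) x) (empty x))
    on t (inj₂ r) =
      trans (zeroRegions-measure t subspace Q) (measure-cong μ λ x → cong (_∧ (zeroSet t ∩ Q) x) (member-≡ x))
      where open Restriction r

-- Randomized trees

errorSet : {n c : ℕ} → (Point n → Bool) → PDT n c → Point n → Bool
errorSet f t x = not ⌊ run t x ≟B f x ⌋

module _ {n c : ℕ} (f : Point n → Bool) (R : RPDT n c) where

  errorProb : Point n → ℚ
  errorProb x = ∑[ p ∈ R ] (if errorSet f (proj₂ p) x then proj₁ p else 0ℚ)

  errorProb+probOut : (x : Point n) → errorProb x + probOut R x (f x) ≡ ∑ R proj₁
  errorProb+probOut x = trans (sym (∑-+ R _ _)) (∑-cong R λ p → if-not-+ ⌊ run (proj₂ p) x ≟B f x ⌋ (proj₁ p))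
    where
    if-not-+ : ∀ b w → (if not b then w else 0ℚ) + (if b then w else 0ℚ) ≡ w
    if-not-+ true  w = +-identityˡ w
    if-not-+ false w = +-identityʳ w

  expected-errorMass : (μ : Point n → ℚ) →
    ∑[ p ∈ R ] (proj₁ p * measure μ (errorSet f (proj₂ p))) ≡ ∑[ x ∈ allPoints n ] (μ x * errorProb x)
  expected-errorMass μ = begin
      ∑[ p ∈ R ] (proj₁ p * ∑[ x ∈ X ] indicator μ (errorSet f (proj₂ p)) x)
    ≡⟨ ∑-cong R (λ p → sym (∑-*ˡ X (proj₁ p) _)) ⟩
      ∑[ p ∈ R ] ∑[ x ∈ X ] (proj₁ p * indicator μ (errorSet f (proj₂ p)) x)
    ≡⟨ ∑-comm R X _ ⟩
      ∑[ x ∈ X ] ∑[ p ∈ R ] (proj₁ p * indicator μ (errorSet f (proj₂ p)) x)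
    ≡⟨ ∑-cong X (λ x → trans (∑-cong R λ p → *-if-comm (errorSet f (proj₂ p) x) (proj₁ p) (μ x))
                              (∑-*ˡ R (μ x) _)) ⟩
      ∑[ x ∈ X ] (μ x * errorProb x)
    ∎
    where
    open ≡-Reasoning
    X = allPoints n
    *-if-comm : ∀ b (w m : ℚ) → w * (if b then m else 0ℚ) ≡ m * (if b then w else 0ℚ)
    *-if-comm true  w m = *-comm w m
    *-if-comm false w m = trans (*-zeroʳ w) (sym (*-zeroʳ m))

module _ {n c : ℕ} {f : Point n → Bool} {μ : Point n → ℚ} {ε : ℚ} where

  low-error-tree : IsDistribution μ → (R : RPDT n c) → EpsErr f ε R →
    Σ (PDT n c) λ t → measure μ (errorSet f t) ≤ ε
  low-error-tree (μ≥0 , μ-total) R ((w≥0 , w-total) , correct) = proj₂ best , error≤ε (lookup-result witness)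
    where
    errorMass : ℚ × PDT n c → ℚ
    errorMass (w , t) = w * measure μ (errorSet f t)
    errorMass≥0 = All.map (λ w≥0 → *-nonNeg w≥0 (measure-nonNeg μ μ≥0 _)) w≥0
    0<∑w : 0ℚ < ∑ R proj₁
    0<∑w = <-≤-trans (positive⁻¹ 1ℚ) (≤-reflexive (sym w-total))
    average≤ : ∑ R errorMass ≤ ε * ∑ R proj₁
    average≤ = begin
      ∑ R errorMass                 ≡⟨ expected-errorMass f R μ ⟩
      ∑[ x ∈ X ] (μ x * errorProb f R x)
        ≤⟨ ∑-mono-≤ X (λ x → *-monoˡ-≤-nonNeg (μ x) {{nonNegative (μ≥0 x)}} (errorProb≤ε x)) ⟩
      ∑[ x ∈ X ] (μ x * ε)          ≡⟨ trans (∑-cong X λ x → *-comm (μ x) ε) (∑-*ˡ X ε μ) ⟩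
      ε * ∑ X μ                     ≡⟨ cong (ε *_) (trans μ-total (sym w-total)) ⟩
      ε * ∑ R proj₁                 ∎
      where
      open ≤-Reasoning
      X = allPoints n
      errorProb≤ε : ∀ x → errorProb f R x ≤ ε
      errorProb≤ε x = complement-≤ (trans (errorProb+probOut f R x) w-total) (correct x)
    witness = ratio-witness ε errorMass proj₁ R errorMass≥0 w≥0 average≤ 0<∑w
    best = Any.lookup witness
    error≤ε : RatioAtMost ε errorMass proj₁ best → measure μ (errorSet f (proj₂ best)) ≤ ε
    error≤ε (we≤εw , w>0) =
      *-cancelˡ-≤-pos (proj₁ best) {{positive w>0}} (≤-trans we≤εw (≤-reflexive (*-comm ε _)))

ratio-bound : ∀ {a b e ε} → a ≤ e → e ≤ ε → ε ≤ + 1 / 8 → 0ℚ ≤ e → ½ ≤ b + e →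
  a ≤ (+ 4 / 1) * ε * b × 0ℚ < b
-- b ≥ ½ − ε ≥ 3/8, and 4ε · 3/8 ≥ ε.
ratio-bound {a} {b} {e} {ε} a≤e e≤ε ε≤⅛ e≥0 ½≤b+e = a≤4εb , <-≤-trans (positive⁻¹ (+ 3 / 8)) b≥⅜
  where
  ε≥0 : 0ℚ ≤ ε
  ε≥0 = ≤-trans e≥0 e≤ε
  b≥⅜ : + 3 / 8 ≤ b
  b≥⅜ = +-cancel-≤ (≤-refl {+ 1 / 8}) (begin
    + 1 / 8 + + 3 / 8  ≡⟨⟩
    ½                  ≤⟨ ½≤b+e ⟩
    b + e              ≤⟨ +-monoʳ-≤ b (≤-trans e≤ε ε≤⅛) ⟩
    b + + 1 / 8        ≡⟨ +-comm b _ ⟩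
    + 1 / 8 + b        ∎)
    where open ≤-Reasoning
  a≤4εb : a ≤ (+ 4 / 1) * ε * b
  a≤4εb = begin
    a                          ≤⟨ ≤-trans a≤e e≤ε ⟩
    ε                          ≡⟨ sym (*-identityʳ ε) ⟩
    ε * 1ℚ                     ≤⟨ *-monoˡ-≤-nonNeg ε {{nonNegative ε≥0}} (toWitness {a? = 1ℚ ≤? + 3 / 2} _) ⟩
    ε * (+ 3 / 2)              ≡⟨ sym (trans (cong (_* (+ 3 / 8)) (*-comm (+ 4 / 1) ε)) (*-assoc ε (+ 4 / 1) (+ 3 / 8))) ⟩
    (+ 4 / 1) * ε * (+ 3 / 8)  ≤⟨ *-monoˡ-≤-nonNeg ((+ 4 / 1) * ε) {{nonNegative 4ε≥0}} b≥⅜ ⟩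
    (+ 4 / 1) * ε * b          ∎
    where
    open ≤-Reasoning
    4ε≥0 = *-nonNeg (nonNegative⁻¹ (+ 4 / 1)) ε≥0

everywhere : {n : ℕ} → Point n → Bool
everywhere _ = true

module _ {n c : ℕ} (f : Point n → Bool) (t : PDT n c) (A : Point n → Bool) where

  ∩-zeroSet-preimage-true⊆errorSet : ∀ x → T ((A ∩ (zeroSet t ∩ preimage f true)) x) → T (errorSet f t x)
  ∩-zeroSet-preimage-true⊆errorSet x h with A x | run t x | f x
  ... | true | false | true = _

  preimage-false⊆∩-zeroSet∪errorSet : (∀ x → T (A x)) →
    ∀ x → T (preimage f false x) → T ((A ∩ (zeroSet t ∩ everywhere)) x) ⊎ T (errorSet f t x)
  preimage-false⊆∩-zeroSet∪errorSet A-full x h with A x | A-full x | run t x | f x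
  ... | true | _ | false | false = inj₁ _
  ... | true | _ | true  | false = inj₂ _

low-error-tree⇒affine-subspace : {n c : ℕ} {f : Point n → Bool} {μ : Point n → ℚ} {ε : ℚ} →
  (∀ x → 0ℚ ≤ μ x) → measure μ (preimage f false) ≡ ½ → ε ≤ + 1 / 8 →
  (t : PDT n c) → measure μ (errorSet f t) ≤ ε →
  Σ (Affine n) λ W →
    measure μ (member W ∩ preimage f true) ≤ (+ 4 / 1) * ε * measure μ (member W) × codim W ℕ≤ c
low-error-tree⇒affine-subspace {n} {c} {f} {μ} {ε} μ≥0 μ[f⁻¹0]≡½ ε≤⅛ t error≤ε = V , ratio≤ , codim≤
  where
  F = fullSpace n
  mass : (Point n → Bool) → Affine n → ℚ
  mass Q V = measure μ (member V ∩ Q)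
  bounds = ratio-bound
    (≤-trans (≤-reflexive (zeroRegions-measure μ t F (preimage f true)))
             (measure-mono μ μ≥0 (∩-zeroSet-preimage-true⊆errorSet f t (member F))))
    error≤ε ε≤⅛ (measure-nonNeg μ μ≥0 _)
    (≤-trans (≤-reflexive (sym μ[f⁻¹0]≡½)) (≤-trans
      (measure-subadditive μ μ≥0 (preimage-false⊆∩-zeroSet∪errorSet f t (member F) member-fullSpace))
      (≤-reflexive (cong (_+ measure μ (errorSet f t)) (sym (zeroRegions-measure μ t F everywhere))))))
  mass≥0 : ∀ Q → All (λ V → 0ℚ ≤ mass Q V) (zeroRegions t F)
  mass≥0 Q = All.universal (λ V → measure-nonNeg μ μ≥0 _) _
  witness = ratio-witness ((+ 4 / 1) * ε) (mass (preimage f true)) (mass everywhere) (zeroRegions t F)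
    (mass≥0 (preimage f true)) (mass≥0 everywhere) (proj₁ bounds) (proj₂ bounds)
  V = Any.lookup witness
  codim≤ : codim V ℕ≤ c
  codim≤ = subst (λ d → codim V ℕ≤ d ℕ.+ c) (codim-fullSpace n)
                 (proj₁ (All.lookupAny (zeroRegions-codim t F) witness))
  ratio≤ = subst (λ m → mass (preimage f true) V ≤ (+ 4 / 1) * ε * m)
    (measure-cong μ λ x → ∧-identityʳ (member V x)) (proj₁ (lookup-result witness))

mainTheorem4 : (n c : ℕ) (f : Point n → Bool) (μ : Point n → ℚ) (ε : ℚ) →
  IsDistribution μ →
  measure μ (preimage f false) ≡ ½ →
  ε ≤ + 1 / 8 →
  (R : RPDT n c) → EpsErr f ε R →
  Σ (Affine n) (λ W →
    (measure μ (member W ∩ preimage f true) ≤ (+ 4 / 1) * ε * measure μ (member W))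
    × (codim W ℕ≤ c))
mainTheorem4 n c f μ ε μ-dist μ[f⁻¹0]≡½ ε≤⅛ R err =
  let t , error≤ε = low-error-tree μ-dist R err
  in low-error-tree⇒affine-subspace (proj₁ μ-dist) μ[f⁻¹0]≡½ ε≤⅛ t error≤ε
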